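{- For every integer $k\ge0$, $$\phi_k(a;x,y,t,u)=f_k(a;x,y,xyt,uy^2),\qquad \varphi_k(a;z,t,u)=g_k(az^{k-1};1/z,t,u/z),$$ where $\phi_k(a;x,y,t,u)=\sum_{n\ge0}\sum_{\pi\in\mathcal{OP}_n^k}x^{(\mathrm{mak}+\mathrm{bInv})(\pi)}y^{\mathrm{cinvLSB}(\pi)}t^{\mathrm{inv}(\pi)}u^{\mathrm{cinv}(\pi)}a^n$, $\varphi_k(a;z,t,u)=\sum_{n\ge0}\sum_{\pi\in\mathcal{OP}_n^k}z^{(\mathrm{lmak}+\mathrm{bInv})(\pi)}t^{\mathrm{inv}(\pi)}u^{\mathrm{cinv}(\pi)}a^n$, $f_k(a;x,y,t,u)=\sum_{n\ge0}\sum_{\pi\in\mathcal{OP}_n^k}x^{(\mathrm{lcs}+\mathrm{rcs})(\pi)+\mathrm{rsb}(\mathcal T\cup\mathcal C)(\pi)}y^{(\mathrm{lsb}+\mathrm{rsb})(\mathcal O\cup\mathcal S)(\pi)+\mathrm{lsb}(\mathcal T\cup\mathcal C)(\pi)}t^{\mathrm{inv}(\pi)}u^{\mathrm{cinv}(\pi)}a^n$, $g_k(a;z,t,u)=\sum_{n\ge0}\sum_{\pi\in\mathcal{OP}_n^k}z^{(\mathrm{lcs}+\mathrm{rcs}+\mathrm{lsb})(\mathcal T\cup\mathcal C)(\pi)}t^{\mathrm{inv}(\pi)}u^{\mathrm{cinv}(\pi)}a^n$.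
   Context: $\mathcal{OP}_n^k$: ordered partitions $\pi=(B_1,\dots,B_k)$ of $[n]$ into $k$ nonempty pairwise disjoint blocks ($\mathcal{OP}_0^0$ = the empty ordered partition). Opener/closer = least/greatest element of a block; $\mathrm{block}(i)=j$ iff $i\in B_j$. For $i\in[n]$: $\mathrm{ros}_i$, $\mathrm{los}_i$ = numbers of openers $j<i$ in blocks to the right, resp. left, of $\mathrm{block}(i)$; $\mathrm{rcs}_i$, $\mathrm{lcs}_i$ = numbers of closers $j<i$ in blocks to the right, resp. left, of $\mathrm{block}(i)$; $\mathrm{rsb}_i$, $\mathrm{lsb}_i$ = numbers of blocks $B$ to the right, resp. left, of the block containing $i$ with $\min B<i<\max B$. $s(\pi)=\sum_{i\in[n]}s_i(\pi)$, $s(A)(\pi)=\sum_{i\in A(\pi)}s_i(\pi)$, sums coordinatewise. $\mathcal S,\mathcal O,\mathcal C,\mathcal T$: singletons (elements of one-element blocks), and, in blocks of size $\ge2$, minima, maxima, and other elements, respectively. $\mathrm{bInv}$ = number of pairs $a<b$ with all of $B_a$ greater than all of $B_b$; $\mathrm{inv}$ = number of pairs $a<b$ with $\min B_a>\min B_b$; $\mathrm{cinv}=\binom k2-\mathrm{inv}$; $\mathrm{mak}=\mathrm{ros}+\mathrm{lcs}$; $\mathrm{lmak}=n(k-1)-(\mathrm{los}+\mathrm{rcs})$; $\mathrm{cinvLSB}=\mathrm{lsb}+2\binom k2-\mathrm{bInv}$. -}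

module Defs where

open import Data.Bool using (Bool; true; false; _∧_; _∨_; not; if_then_else_)
open import Data.Nat using (ℕ; zero; suc; _+_; _*_; _∸_; _⊓_; _⊔_; _<ᵇ_; _≡ᵇ_)
open import Data.Nat.Combinatorics using (_C_)
open import Data.Integer as ℤ using (ℤ; +_)
open import Data.Fin using (Fin; toℕ)
open import Data.List using (List; []; _∷_; map; filter; foldr; allFin; concatMap; length)
open import Data.Bool.ListAction using (all; any)
open import Data.Nat.ListAction using (sum)
open import Data.Product using (_×_; _,_)
open import Data.Bool.Properties using (T?)
open import Data.Vec using (Vec; lookup) renaming ([] to []ᵥ; _∷_ to _∷ᵥ_)

-- An ordered partition π = (B_1,…,B_k) of [n] is encoded by its block map
-- v : Vec (Fin k) n, where element i (Fin n, i.e. the integer toℕ i + 1)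
-- lies in block number (lookup v i) (blocks numbered 0..k-1, left to right).
-- Ordered partitions into k NONEMPTY blocks = surjective block maps.

cnt : {A : Set} → (A → Bool) → List A → ℕ
cnt p xs = length (filter (λ x → T? (p x)) xs)

allVecs : (n k : ℕ) → List (Vec (Fin k) n)
allVecs zero    k = []ᵥ ∷ []
allVecs (suc n) k = concatMap (λ v → map (_∷ᵥ v) (allFin k)) (allVecs n k)

isSurj : {n k : ℕ} → Vec (Fin k) n → Bool
isSurj {n} {k} v = all (λ b → any (λ i → toℕ (lookup v i) ≡ᵇ toℕ b) (allFin n)) (allFin k)

OP : (n k : ℕ) → List (Vec (Fin k) n)
OP n k = filter (λ v → T? (isSurj v)) (allVecs n k)

module Stats {n k : ℕ} (π : Vec (Fin k) n) where

  elems : List (Fin n)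
  elems = allFin n

  blocks : List (Fin k)
  blocks = allFin k

  blk : Fin n → ℕ
  blk i = toℕ (lookup π i)

  inB : Fin k → Fin n → Bool
  inB b i = blk i ≡ᵇ toℕ b

  -- min / max of block b (positions in 0..n-1); blocks are nonempty on OP
  minB : Fin k → ℕ
  minB b = foldr _⊓_ n (map toℕ (filter (λ i → T? (inB b i)) elems))
  maxB : Fin k → ℕ
  maxB b = foldr _⊔_ 0 (map toℕ (filter (λ i → T? (inB b i)) elems))

  opener : Fin n → Bool
  opener i = toℕ i ≡ᵇ minB (lookup π i)
  closer : Fin n → Bool
  closer i = toℕ i ≡ᵇ maxB (lookup π i)

  ros los rcs lcs rsb lsb : Fin n → ℕ
  ros i = cnt (λ j → (toℕ j <ᵇ toℕ i) ∧ opener j ∧ (blk i <ᵇ blk j)) elems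
  los i = cnt (λ j → (toℕ j <ᵇ toℕ i) ∧ opener j ∧ (blk j <ᵇ blk i)) elems
  rcs i = cnt (λ j → (toℕ j <ᵇ toℕ i) ∧ closer j ∧ (blk i <ᵇ blk j)) elems
  lcs i = cnt (λ j → (toℕ j <ᵇ toℕ i) ∧ closer j ∧ (blk j <ᵇ blk i)) elems
  rsb i = cnt (λ b → (blk i <ᵇ toℕ b) ∧ (minB b <ᵇ toℕ i) ∧ (toℕ i <ᵇ maxB b)) blocks
  lsb i = cnt (λ b → (toℕ b <ᵇ blk i) ∧ (minB b <ᵇ toℕ i) ∧ (toℕ i <ᵇ maxB b)) blocks

  -- s(π) = Σ_{i∈[n]} s_i(π);  s(A)(π) = Σ_{i∈A(π)} s_i(π) for A given by a predicate
  tot : (Fin n → ℕ) → ℕ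
  tot s = sum (map s elems)
  totOn : (Fin n → Bool) → (Fin n → ℕ) → ℕ
  totOn A s = sum (map (λ i → if A i then s i else 0) elems)

  inS inO inC inT : Fin n → Bool
  inS i = opener i ∧ closer i
  inO i = opener i ∧ not (closer i)
  inC i = closer i ∧ not (opener i)
  inT i = not (opener i) ∧ not (closer i)

  OS TC : Fin n → Bool
  OS i = inO i ∨ inS i
  TC i = inT i ∨ inC i

  pairs : List (Fin k × Fin k)
  pairs = concatMap (λ a → map (a ,_) (filter (λ b → T? (toℕ a <ᵇ toℕ b)) blocks)) blocks

  bInv inv cinv : ℕ
  -- all of B_a greater than all of B_b  ⇔  min B_a > max B_b (blocks nonempty)
  bInv = cnt (λ { (a , b) → maxB b <ᵇ minB a }) pairs
  inv  = cnt (λ { (a , b) → minB b <ᵇ minB a }) pairs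
  cinv = (k C 2) ∸ inv

  mak : ℕ
  mak = tot ros + tot lcs
  lmak : ℤ
  lmak = ((+ n) ℤ.* ((+ k) ℤ.- (+ 1))) ℤ.- (+ (tot los + tot rcs))
  cinvLSB : ℕ
  cinvLSB = (tot lsb + 2 * (k C 2)) ∸ bInv

  φx φy : ℕ
  φx = mak + bInv
  φy = cinvLSB
  ϕz : ℤ
  ϕz = lmak ℤ.+ (+ bInv)
  fx fy : ℕ
  fx = tot lcs + tot rcs + totOn TC rsb
  fy = totOn OS lsb + totOn OS rsb + totOn TC lsb
  gz : ℕ
  gz = totOn TC lcs + totOn TC rcs + totOn TC lsb

-- Each identity holds partition by partition: φx = fx + inv, φy = fy + inv + 2 cinv and
-- ϕz = n(k − 1) − gz − cinv, so both sides count the same partitions. All three rest on one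
-- dichotomy: a block B ≠ block(i) that opened before i has either closed before i or straddles i
-- (min B < i < max B). Elementwise this gives ros = rcs + rsb and los = lcs + lsb; evaluated at
-- the openers it gives inv = bInv + rsb(O ∪ S), while rcs(O ∪ S) = bInv and los(O ∪ S) counts
-- the non-inversions, i.e. cinv. Every such count becomes a sum over blocks by reindexing
-- openers (closers) by the block they open (close).

module Submission where

open import Defs
open import Data.Bool using (Bool; true; false; T; _∧_; _∨_; not; if_then_else_)
open import Data.Bool.Properties using (T?)
open import Data.Nat using (ℕ; zero; suc; _+_; _*_; _∸_; _⊓_; _⊔_; _≤_; _<_; _<ᵇ_; _≡ᵇ_)
open import Data.Nat.Properties
  using ( +-*-semiring; +-identityʳ; *-identityʳ; *-zeroʳ; *-comm; *-assoc; *-distribˡ-+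
        ; ≤-refl; ≤-trans; ≤-<-trans; <-irrefl; <-asym; <-cmp; <⇒≢; <ᵇ⇒<; <⇒<ᵇ
        ; ≡ᵇ⇒≡; ≡⇒≡ᵇ; n≤0⇒n≡0; m+n∸n≡m; ⊓-sel; ⊔-sel; m≤n⇒m⊓o≤n; m≤n⇒o⊓m≤n; m≤n⇒m≤n⊔o; m≤n⇒m≤o⊔n )
open import Data.Nat.Combinatorics using (_C_; nC1≡n; nCk+nC[k+1]≡[n+1]C[k+1])
open import Data.Nat.Tactic.RingSolver using (solve-∀)
import Data.Nat.ListAction as List
open import Data.Integer as ℤ using (ℤ; +_)
import Data.Integer.Tactic.RingSolver as ℤ-Solver
open import Data.Fin using (Fin; toℕ)
open import Data.Fin.Properties using (toℕ-injective; toℕ<n)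
open import Data.List using (List; []; _∷_; _++_; map; filter; foldr; concatMap; length; tabulate; allFin)
open import Data.List.Properties using (length-++; filter-++; filter-≐)
open import Data.List.Membership.Propositional using (_∈_)
open import Data.List.Membership.Propositional.Properties using (∈-map⁺; ∈-map⁻; ∈-filter⁺; ∈-filter⁻; ∈-allFin; foldr-selective)
open import Data.List.Relation.Unary.Any using (here; there; satisfied)
open import Data.List.Relation.Unary.Any.Properties using (any⁻)
import Data.List.Relation.Unary.All as All
open import Data.List.Relation.Unary.All.Properties using (all⁺)
open import Data.Vec using (Vec; lookup)
open import Data.Product using (_×_; _,_; ∃; proj₁; proj₂)
open import Data.Sum using (inj₁; inj₂)
open import Data.Unit using (tt)
open import Data.Empty using (⊥-elim)
open import Function using (_∘_)
open import Relation.Binary.Definitions using (tri<; tri≈; tri>)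
open import Relation.Binary.PropositionalEquality
  using (_≡_; _≢_; refl; sym; trans; cong; cong₂; subst; module ≡-Reasoning)
open import Relation.Nullary using (¬_)
open import Relation.Nullary.Decidable using (⌊_⌋)
open import Algebra.Properties.Semiring.Sum +-*-semiring
  using (sum-syntax; sum-replicate-zero; sum-cong-≗; ∑-distrib-+; ∑-comm; *-distribʳ-sum)

open ≡-Reasoning

𝟙 : Bool → ℕ
𝟙 true  = 1
𝟙 false = 0

𝟙-T : ∀ {b} → T b → 𝟙 b ≡ 1
𝟙-T {true} _ = refl

𝟙-¬T : ∀ {b} → ¬ T b → 𝟙 b ≡ 0
𝟙-¬T {true}  ¬t = ⊥-elim (¬t tt)
𝟙-¬T {false} _  = refl

𝟙-∧ : ∀ a b → 𝟙 (a ∧ b) ≡ 𝟙 a * 𝟙 b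
𝟙-∧ true  b = sym (+-identityʳ (𝟙 b))
𝟙-∧ false b = refl

𝟙-∧-∧ : ∀ a b c → 𝟙 (a ∧ b ∧ c) ≡ 𝟙 a * (𝟙 b * 𝟙 c)
𝟙-∧-∧ a b c = trans (𝟙-∧ a (b ∧ c)) (cong (𝟙 a *_) (𝟙-∧ b c))

if-then-0≡𝟙* : ∀ b y → (if b then y else 0) ≡ 𝟙 b * y
if-then-0≡𝟙* true  y = sym (+-identityʳ y)
if-then-0≡𝟙* false y = refl

𝟙-split : ∀ b y → y ≡ 𝟙 b * y + 𝟙 (not b) * y
𝟙-split true  y = trans (sym (+-identityʳ y)) (cong (_+ 0) (sym (+-identityʳ y)))
𝟙-split false y = sym (+-identityʳ y)

𝟙*-cong : ∀ c {x y} → (T c → x ≡ y) → 𝟙 c * x ≡ 𝟙 c * y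
𝟙*-cong true  x≡y = cong (_+ 0) (x≡y tt)
𝟙*-cong false _   = refl

∧-congˡ-T : ∀ a {b c} → (T a → b ≡ c) → a ∧ b ≡ a ∧ c
∧-congˡ-T true  b≡c = b≡c tt
∧-congˡ-T false _   = refl

𝟙-implied : ∀ {a} b → (T a → T b) → 𝟙 a ≡ 𝟙 b * 𝟙 a
𝟙-implied {false} b _   = sym (*-zeroʳ (𝟙 b))
𝟙-implied {true}  b a⇒b = sym (trans (*-identityʳ (𝟙 b)) (𝟙-T (a⇒b tt)))

𝟙-<ᵇ-straddle : ∀ {m M x} → m ≤ M → x ≢ M →
  𝟙 (m <ᵇ x) ≡ 𝟙 (M <ᵇ x) + 𝟙 (m <ᵇ x) * 𝟙 (x <ᵇ M)
𝟙-<ᵇ-straddle {m} {M} {x} m≤M x≢M with <-cmp x M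
... | tri≈ _ x≡M _ = ⊥-elim (x≢M x≡M)
... | tri< x<M _ _
  rewrite 𝟙-¬T {M <ᵇ x} (<-asym x<M ∘ <ᵇ⇒< M x) | 𝟙-T (<⇒<ᵇ x<M) = sym (*-identityʳ _)
... | tri> _ _ M<x
  rewrite 𝟙-T (<⇒<ᵇ M<x) | 𝟙-T (<⇒<ᵇ (≤-<-trans m≤M M<x)) | 𝟙-¬T {x <ᵇ M} (<-asym M<x ∘ <ᵇ⇒< x M) = refl

𝟙-<ᵇ-total : ∀ {x y} → x ≢ y → 𝟙 (x <ᵇ y) + 𝟙 (y <ᵇ x) ≡ 1
𝟙-<ᵇ-total {x} {y} x≢y with <-cmp x y
... | tri≈ _ x≡y _ = ⊥-elim (x≢y x≡y)
... | tri< x<y _ _ rewrite 𝟙-T (<⇒<ᵇ x<y) | 𝟙-¬T {y <ᵇ x} (<-asym x<y ∘ <ᵇ⇒< y x) = refl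
... | tri> _ _ y<x rewrite 𝟙-T (<⇒<ᵇ y<x) | 𝟙-¬T {x <ᵇ y} (<-asym y<x ∘ <ᵇ⇒< x y) = refl

toℕ-<ᵇ⇒≢ : ∀ {k} {a b : Fin k} → T (toℕ a <ᵇ toℕ b) → a ≢ b
toℕ-<ᵇ⇒≢ a<b = <⇒≢ (<ᵇ⇒< _ _ a<b) ∘ cong toℕ

∑-δ : ∀ {n} (x : Fin n) (f : Fin n → ℕ) → ∑[ y < n ] (𝟙 (toℕ y ≡ᵇ toℕ x) * f y) ≡ f x
∑-δ {suc n} Fin.zero    f = trans (cong₂ _+_ (+-identityʳ (f Fin.zero)) (sum-replicate-zero n)) (+-identityʳ _)
∑-δ         (Fin.suc x) f = ∑-δ x (f ∘ Fin.suc)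

∑∑-𝟙-<ᵇ : ∀ k → ∑[ a < k ] ∑[ b < k ] 𝟙 (toℕ a <ᵇ toℕ b) ≡ k C 2
∑∑-𝟙-<ᵇ zero    = refl
∑∑-𝟙-<ᵇ (suc k) = begin
  ∑[ b < k ] 1 + ∑[ a < k ] ∑[ b < k ] 𝟙 (toℕ a <ᵇ toℕ b) ≡⟨ cong₂ _+_ (∑-1 k) (∑∑-𝟙-<ᵇ k) ⟩
  k + k C 2                                               ≡⟨ cong (_+ k C 2) (sym (nC1≡n k)) ⟩
  k C 1 + k C 2                                           ≡⟨ nCk+nC[k+1]≡[n+1]C[k+1] k 1 ⟩
  suc k C 2                                               ∎
  where
  ∑-1 : ∀ k → ∑[ b < k ] 1 ≡ k
  ∑-1 zero    = refl
  ∑-1 (suc k) = cong suc (∑-1 k)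

module _ {n k} (β : Fin n → Fin k) (σ : Fin k → Fin n) (β∘σ≗id : ∀ b → β (σ b) ≡ b) where

  ∑-fibre-of-section : ∀ j → ∑[ b < k ] 𝟙 (toℕ j ≡ᵇ toℕ (σ b)) ≡ 𝟙 (toℕ j ≡ᵇ toℕ (σ (β j)))
  ∑-fibre-of-section j = begin
    ∑[ b < k ] 𝟙 (toℕ j ≡ᵇ toℕ (σ b))
      ≡⟨ sum-cong-≗ (λ b → 𝟙-implied (toℕ b ≡ᵇ toℕ (β j)) (in-fibre b)) ⟩
    ∑[ b < k ] (𝟙 (toℕ b ≡ᵇ toℕ (β j)) * 𝟙 (toℕ j ≡ᵇ toℕ (σ b)))
      ≡⟨ ∑-δ (β j) (λ b → 𝟙 (toℕ j ≡ᵇ toℕ (σ b))) ⟩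
    𝟙 (toℕ j ≡ᵇ toℕ (σ (β j))) ∎
    where
    in-fibre : ∀ b → T (toℕ j ≡ᵇ toℕ (σ b)) → T (toℕ b ≡ᵇ toℕ (β j))
    in-fibre b j≡σb = ≡⇒≡ᵇ _ _ (cong toℕ (trans (sym (β∘σ≗id b))
                        (cong β (sym (toℕ-injective (≡ᵇ⇒≡ _ _ j≡σb))))))

  ∑-over-section : ∀ (h : Fin n → ℕ) →
    ∑[ j < n ] (𝟙 (toℕ j ≡ᵇ toℕ (σ (β j))) * h j) ≡ ∑[ b < k ] h (σ b)
  ∑-over-section h = begin
    ∑[ j < n ] (𝟙 (toℕ j ≡ᵇ toℕ (σ (β j))) * h j)
      ≡⟨ sum-cong-≗ (λ j → cong (_* h j) (sym (∑-fibre-of-section j))) ⟩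
    ∑[ j < n ] (∑[ b < k ] 𝟙 (toℕ j ≡ᵇ toℕ (σ b)) * h j)
      ≡⟨ sum-cong-≗ (λ j → *-distribʳ-sum (h j) (λ b → 𝟙 (toℕ j ≡ᵇ toℕ (σ b)))) ⟩
    ∑[ j < n ] ∑[ b < k ] (𝟙 (toℕ j ≡ᵇ toℕ (σ b)) * h j)
      ≡⟨ ∑-comm (λ j b → 𝟙 (toℕ j ≡ᵇ toℕ (σ b)) * h j) ⟩
    ∑[ b < k ] ∑[ j < n ] (𝟙 (toℕ j ≡ᵇ toℕ (σ b)) * h j)
      ≡⟨ sum-cong-≗ (λ b → ∑-δ (σ b) h) ⟩
    ∑[ b < k ] h (σ b) ∎

cnt-cong : ∀ {A : Set} {p q : A → Bool} → (∀ x → p x ≡ q x) → ∀ xs → cnt p xs ≡ cnt q xs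
cnt-cong {p = p} {q} p≗q xs =
  cong length (filter-≐ (λ x → T? (p x)) (λ x → T? (q x))
                        ((λ {x} → subst T (p≗q x)) , (λ {x} → subst T (sym (p≗q x)))) xs)

cnt-++ : ∀ {A : Set} (p : A → Bool) xs ys → cnt p (xs ++ ys) ≡ cnt p xs + cnt p ys
cnt-++ p xs ys = trans (cong length (filter-++ (λ x → T? (p x)) xs ys)) (length-++ (filter (λ x → T? (p x)) xs))

cnt-concatMap : ∀ {A B : Set} (p : B → Bool) (g : A → List B) xs →
  cnt p (concatMap g xs) ≡ List.sum (map (λ a → cnt p (g a)) xs)
cnt-concatMap p g []       = refl
cnt-concatMap p g (x ∷ xs) = trans (cnt-++ p (g x) (concatMap g xs)) (cong (_+_ (cnt p (g x))) (cnt-concatMap p g xs))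

cnt-map : ∀ {A B : Set} (p : B → Bool) (g : A → B) xs → cnt p (map g xs) ≡ cnt (p ∘ g) xs
cnt-map p g []       = refl
cnt-map p g (x ∷ xs) with p (g x)
... | true  = cong suc (cnt-map p g xs)
... | false = cnt-map p g xs

cnt-filter : ∀ {A : Set} (q p : A → Bool) xs → cnt p (filter (λ x → T? (q x)) xs) ≡ cnt (λ x → q x ∧ p x) xs
cnt-filter q p []       = refl
cnt-filter q p (x ∷ xs) with q x
... | false = cnt-filter q p xs
... | true with p x
...   | true  = cong suc (cnt-filter q p xs)
...   | false = cnt-filter q p xs

cnt-as-sum : ∀ {A : Set} (p : A → Bool) xs → cnt p xs ≡ List.sum (map (𝟙 ∘ p) xs)
cnt-as-sum p []       = refl
cnt-as-sum p (x ∷ xs) with p x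
... | true  = cong suc (cnt-as-sum p xs)
... | false = cnt-as-sum p xs

sum-map-tabulate : ∀ {A : Set} {n} (f : A → ℕ) (g : Fin n → A) → List.sum (map f (tabulate g)) ≡ ∑[ i < n ] f (g i)
sum-map-tabulate {n = zero}  f g = refl
sum-map-tabulate {n = suc n} f g = cong (_+_ (f (g Fin.zero))) (sum-map-tabulate f (g ∘ Fin.suc))

sum-map-allFin : ∀ {n} (f : Fin n → ℕ) → List.sum (map f (allFin n)) ≡ ∑[ i < n ] f i
sum-map-allFin f = sum-map-tabulate f (λ i → i)

cnt-allFin : ∀ {n} (p : Fin n → Bool) → cnt p (allFin n) ≡ ∑[ i < n ] 𝟙 (p i)
cnt-allFin {n} p = trans (cnt-as-sum p (allFin n)) (sum-map-allFin (𝟙 ∘ p))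

foldr-⊓-≤ : ∀ d {x xs} → x ∈ xs → foldr _⊓_ d xs ≤ x
foldr-⊓-≤ d              (here refl) = m≤n⇒m⊓o≤n _ ≤-refl
foldr-⊓-≤ d {xs = y ∷ _} (there x∈)  = m≤n⇒o⊓m≤n y (foldr-⊓-≤ d x∈)

foldr-⊔-≥ : ∀ {x xs} → x ∈ xs → x ≤ foldr _⊔_ 0 xs
foldr-⊔-≥              (here refl) = m≤n⇒m≤n⊔o _ ≤-refl
foldr-⊔-≥ {xs = y ∷ _} (there x∈)  = m≤n⇒m≤o⊔n y (foldr-⊔-≥ x∈)

foldr-⊓-∈ : ∀ {d x xs} → x ∈ xs → x < d → foldr _⊓_ d xs ∈ xs
foldr-⊓-∈ {d} {x} {xs} x∈ x<d with foldr-selective ⊓-sel d xs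
... | inj₂ min∈ = min∈
... | inj₁ min≡d = ⊥-elim (<-irrefl refl (≤-<-trans (subst (_≤ x) min≡d (foldr-⊓-≤ d x∈)) x<d))

foldr-⊔-∈ : ∀ {x xs} → x ∈ xs → foldr _⊔_ 0 xs ∈ xs
foldr-⊔-∈ {x} {xs} x∈ with foldr-selective ⊔-sel 0 xs
... | inj₂ max∈ = max∈
... | inj₁ max≡0 = subst (_∈ xs) (trans (n≤0⇒n≡0 (subst (x ≤_) max≡0 (foldr-⊔-≥ x∈))) (sym max≡0)) x∈

module _ {n k} (π : Vec (Fin k) n) where
  open Stats π

  members : Fin k → List ℕ
  members b = map toℕ (filter (λ i → T? (inB b i)) elems)

  ∈-members : ∀ i → toℕ i ∈ members (lookup π i)
  ∈-members i =
    ∈-map⁺ toℕ (∈-filter⁺ (λ j → T? (inB (lookup π i) j)) (∈-allFin i) (≡⇒≡ᵇ (blk i) (blk i) refl))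

  ∈-members⁻ : ∀ {b y} → y ∈ members b → ∃ λ i → lookup π i ≡ b × toℕ i ≡ y
  ∈-members⁻ {b} y∈ with ∈-map⁻ toℕ y∈
  ... | i , i∈ , refl =
    i , toℕ-injective (≡ᵇ⇒≡ _ _ (proj₂ (∈-filter⁻ (λ j → T? (inB b j)) {xs = elems} i∈))) , refl

  minB-≤ : ∀ i → minB (lookup π i) ≤ toℕ i
  minB-≤ i = foldr-⊓-≤ n (∈-members i)

  ≤-maxB : ∀ i → toℕ i ≤ maxB (lookup π i)
  ≤-maxB i = foldr-⊔-≥ (∈-members i)

  tot-∑ : ∀ s → tot s ≡ ∑[ i < n ] s i
  tot-∑ s = sum-map-allFin s

  totOn-∑ : ∀ A s → totOn A s ≡ ∑[ i < n ] (𝟙 (A i) * s i)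
  totOn-∑ A s = trans (sum-map-allFin (λ i → if A i then s i else 0)) (sum-cong-≗ (λ i → if-then-0≡𝟙* (A i) (s i)))

  totOn-OS : ∀ s → totOn OS s ≡ ∑[ i < n ] (𝟙 (opener i) * s i)
  totOn-OS s = trans (totOn-∑ OS s) (sum-cong-≗ (λ i → cong (λ b → 𝟙 b * s i) (OS≡opener (opener i) (closer i))))
    where
    OS≡opener : ∀ o c → (o ∧ not c) ∨ (o ∧ c) ≡ o
    OS≡opener true  true  = refl
    OS≡opener true  false = refl
    OS≡opener false _     = refl

  totOn-TC : ∀ s → totOn TC s ≡ ∑[ i < n ] (𝟙 (not (opener i)) * s i)
  totOn-TC s = trans (totOn-∑ TC s) (sum-cong-≗ (λ i → cong (λ b → 𝟙 b * s i) (TC≡not-opener (opener i) (closer i))))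
    where
    TC≡not-opener : ∀ o c → (not o ∧ not c) ∨ (c ∧ not o) ≡ not o
    TC≡not-opener true  true  = refl
    TC≡not-opener true  false = refl
    TC≡not-opener false true  = refl
    TC≡not-opener false false = refl

  tot-split : ∀ s → tot s ≡ totOn OS s + totOn TC s
  tot-split s = begin
    tot s
      ≡⟨ tot-∑ s ⟩
    ∑[ i < n ] s i
      ≡⟨ sum-cong-≗ (λ i → 𝟙-split (opener i) (s i)) ⟩
    ∑[ i < n ] (𝟙 (opener i) * s i + 𝟙 (not (opener i)) * s i)
      ≡⟨ ∑-distrib-+ (λ i → 𝟙 (opener i) * s i) _ ⟩
    ∑[ i < n ] (𝟙 (opener i) * s i) + ∑[ i < n ] (𝟙 (not (opener i)) * s i)
      ≡⟨ sym (cong₂ _+_ (totOn-OS s) (totOn-TC s)) ⟩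
    totOn OS s + totOn TC s ∎

  tot-+ : ∀ {s f g} → (∀ i → s i ≡ f i + g i) → tot s ≡ tot f + tot g
  tot-+ {s} {f} {g} s≗f+g = begin
    tot s
      ≡⟨ trans (tot-∑ s) (sum-cong-≗ s≗f+g) ⟩
    ∑[ i < n ] (f i + g i)
      ≡⟨ ∑-distrib-+ f g ⟩
    ∑[ i < n ] f i + ∑[ i < n ] g i
      ≡⟨ sym (cong₂ _+_ (tot-∑ f) (tot-∑ g)) ⟩
    tot f + tot g ∎

  totOn-+ : ∀ A {s f g} → (∀ i → s i ≡ f i + g i) → totOn A s ≡ totOn A f + totOn A g
  totOn-+ A {s} {f} {g} s≗f+g = begin
    totOn A s
      ≡⟨ totOn-∑ A s ⟩
    ∑[ i < n ] (𝟙 (A i) * s i)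
      ≡⟨ sum-cong-≗ (λ i → trans (cong (𝟙 (A i) *_) (s≗f+g i)) (*-distribˡ-+ (𝟙 (A i)) (f i) (g i))) ⟩
    ∑[ i < n ] (𝟙 (A i) * f i + 𝟙 (A i) * g i)
      ≡⟨ ∑-distrib-+ (λ i → 𝟙 (A i) * f i) _ ⟩
    ∑[ i < n ] (𝟙 (A i) * f i) + ∑[ i < n ] (𝟙 (A i) * g i)
      ≡⟨ sym (cong₂ _+_ (totOn-∑ A f) (totOn-∑ A g)) ⟩
    totOn A f + totOn A g ∎

  cnt-pairs : ∀ (f : Fin k × Fin k → Bool) →
    cnt f pairs ≡ ∑[ a < k ] ∑[ b < k ] (𝟙 (toℕ a <ᵇ toℕ b) * 𝟙 (f (a , b)))
  cnt-pairs f = begin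
    cnt f pairs
      ≡⟨ cnt-concatMap f row blocks ⟩
    List.sum (map (λ a → cnt f (row a)) blocks)
      ≡⟨ sum-map-allFin (λ a → cnt f (row a)) ⟩
    ∑[ a < k ] cnt f (row a)
      ≡⟨ sum-cong-≗ cnt-row ⟩
    ∑[ a < k ] ∑[ b < k ] (𝟙 (toℕ a <ᵇ toℕ b) * 𝟙 (f (a , b))) ∎
    where
    row : Fin k → List (Fin k × Fin k)
    row a = map (a ,_) (filter (λ b → T? (toℕ a <ᵇ toℕ b)) blocks)
    cnt-row : ∀ a → cnt f (row a) ≡ ∑[ b < k ] (𝟙 (toℕ a <ᵇ toℕ b) * 𝟙 (f (a , b)))
    cnt-row a = begin
      cnt f (row a)
        ≡⟨ cnt-map f (a ,_) (filter (λ b → T? (toℕ a <ᵇ toℕ b)) blocks) ⟩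
      cnt (λ b → f (a , b)) (filter (λ b → T? (toℕ a <ᵇ toℕ b)) blocks)
        ≡⟨ cnt-filter (λ b → toℕ a <ᵇ toℕ b) (λ b → f (a , b)) blocks ⟩
      cnt (λ b → (toℕ a <ᵇ toℕ b) ∧ f (a , b)) blocks
        ≡⟨ cnt-allFin (λ b → (toℕ a <ᵇ toℕ b) ∧ f (a , b)) ⟩
      ∑[ b < k ] 𝟙 ((toℕ a <ᵇ toℕ b) ∧ f (a , b))
        ≡⟨ sum-cong-≗ (λ b → 𝟙-∧ (toℕ a <ᵇ toℕ b) (f (a , b))) ⟩
      ∑[ b < k ] (𝟙 (toℕ a <ᵇ toℕ b) * 𝟙 (f (a , b))) ∎

module Surjective {n k} (π : Vec (Fin k) n) (surj : T (isSurj π)) where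
  open Stats π

  block-inhabited : ∀ b → ∃ λ i → lookup π i ≡ b
  block-inhabited b with satisfied (any⁻ _ elems (All.lookup (all⁺ _ blocks surj) (∈-allFin b)))
  ... | i , i∈b = i , toℕ-injective (≡ᵇ⇒≡ _ _ i∈b)

  first-attained : ∀ b → ∃ λ i → lookup π i ≡ b × toℕ i ≡ minB b
  first-attained b with block-inhabited b
  ... | j , refl = ∈-members⁻ π (foldr-⊓-∈ (∈-members π j) (toℕ<n j))

  last-attained : ∀ b → ∃ λ i → lookup π i ≡ b × toℕ i ≡ maxB b
  last-attained b with block-inhabited b
  ... | j , refl = ∈-members⁻ π (foldr-⊔-∈ (∈-members π j))

  first last : Fin k → Fin n
  first b = proj₁ (first-attained b)
  last  b = proj₁ (last-attained b)

  block-first : ∀ b → lookup π (first b) ≡ b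
  block-first b = proj₁ (proj₂ (first-attained b))

  block-last : ∀ b → lookup π (last b) ≡ b
  block-last b = proj₁ (proj₂ (last-attained b))

  toℕ-first : ∀ b → toℕ (first b) ≡ minB b
  toℕ-first b = proj₂ (proj₂ (first-attained b))

  toℕ-last : ∀ b → toℕ (last b) ≡ maxB b
  toℕ-last b = proj₂ (proj₂ (last-attained b))

  minB≤maxB : ∀ b → minB b ≤ maxB b
  minB≤maxB b = subst (λ c → minB c ≤ maxB c) (block-first b)
                  (≤-trans (minB-≤ π (first b)) (≤-maxB π (first b)))

  ≢block⇒≢maxB : ∀ {i b} → lookup π i ≢ b → toℕ i ≢ maxB b
  ≢block⇒≢maxB {i} {b} i∉b i≡max =
    i∉b (trans (cong (lookup π) (toℕ-injective (trans i≡max (sym (toℕ-last b))))) (block-last b))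

  minB≢maxB : ∀ {a b} → a ≢ b → minB a ≢ maxB b
  minB≢maxB {a} a≢b = subst (_≢ _) (toℕ-first a) (≢block⇒≢maxB (a≢b ∘ trans (sym (block-first a))))

  minB-injective : ∀ {a b} → minB a ≡ minB b → a ≡ b
  minB-injective {a} {b} eq = trans (sym (block-first a))
    (trans (cong (lookup π) (toℕ-injective (trans (toℕ-first a) (trans eq (sym (toℕ-first b)))))) (block-first b))

  module Marked (pos : Fin k → ℕ) (σ : Fin k → Fin n)
                (block-σ : ∀ b → lookup π (σ b) ≡ b) (toℕ-σ : ∀ b → toℕ (σ b) ≡ pos b) where

    ∑-marked : ∀ (H : ℕ → Fin k → ℕ) →
      ∑[ j < n ] (𝟙 (toℕ j ≡ᵇ pos (lookup π j)) * H (toℕ j) (lookup π j)) ≡ ∑[ b < k ] H (pos b) b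
    ∑-marked H = begin
      ∑[ j < n ] (𝟙 (toℕ j ≡ᵇ pos (lookup π j)) * H (toℕ j) (lookup π j))
        ≡⟨ sum-cong-≗ (λ j → cong (λ p → 𝟙 (toℕ j ≡ᵇ p) * H (toℕ j) (lookup π j)) (sym (toℕ-σ (lookup π j)))) ⟩
      ∑[ j < n ] (𝟙 (toℕ j ≡ᵇ toℕ (σ (lookup π j))) * H (toℕ j) (lookup π j))
        ≡⟨ ∑-over-section (lookup π) σ block-σ (λ j → H (toℕ j) (lookup π j)) ⟩
      ∑[ b < k ] H (toℕ (σ b)) (lookup π (σ b))
        ≡⟨ sum-cong-≗ (λ b → cong₂ H (toℕ-σ b) (block-σ b)) ⟩
      ∑[ b < k ] H (pos b) b ∎

    marked-before : ∀ (rel : ℕ → Bool) x →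
      cnt (λ j → (toℕ j <ᵇ x) ∧ (toℕ j ≡ᵇ pos (lookup π j)) ∧ rel (blk j)) elems
      ≡ ∑[ b < k ] (𝟙 (rel (toℕ b)) * 𝟙 (pos b <ᵇ x))
    marked-before rel x = begin
      cnt (λ j → (toℕ j <ᵇ x) ∧ (toℕ j ≡ᵇ pos (lookup π j)) ∧ rel (blk j)) elems
        ≡⟨ cnt-allFin (λ j → (toℕ j <ᵇ x) ∧ (toℕ j ≡ᵇ pos (lookup π j)) ∧ rel (blk j)) ⟩
      ∑[ j < n ] 𝟙 ((toℕ j <ᵇ x) ∧ (toℕ j ≡ᵇ pos (lookup π j)) ∧ rel (blk j))
        ≡⟨ sum-cong-≗ (λ j → reorder (toℕ j <ᵇ x) (toℕ j ≡ᵇ pos (lookup π j)) (rel (blk j))) ⟩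
      ∑[ j < n ] (𝟙 (toℕ j ≡ᵇ pos (lookup π j)) * (𝟙 (rel (blk j)) * 𝟙 (toℕ j <ᵇ x)))
        ≡⟨ ∑-marked (λ y b → 𝟙 (rel (toℕ b)) * 𝟙 (y <ᵇ x)) ⟩
      ∑[ b < k ] (𝟙 (rel (toℕ b)) * 𝟙 (pos b <ᵇ x)) ∎
      where
      reorder : ∀ a m r → 𝟙 (a ∧ m ∧ r) ≡ 𝟙 m * (𝟙 r * 𝟙 a)
      reorder a m r = trans (𝟙-∧-∧ a m r) (trans (*-comm (𝟙 a) (𝟙 m * 𝟙 r)) (*-assoc (𝟙 m) (𝟙 r) (𝟙 a)))

  open Marked minB first block-first toℕ-first using () renaming (∑-marked to ∑-openers; marked-before to openers-before)
  open Marked maxB last block-last toℕ-last using () renaming (marked-before to closers-before)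

  spanning : (Fin k → Bool) → ℕ → ℕ
  spanning c x = ∑[ b < k ] (𝟙 (c b) * (𝟙 (minB b <ᵇ x) * 𝟙 (x <ᵇ maxB b)))

  cnt-spanning : ∀ (c : Fin k → Bool) x →
    cnt (λ b → c b ∧ (minB b <ᵇ x) ∧ (x <ᵇ maxB b)) blocks ≡ spanning c x
  cnt-spanning c x = trans (cnt-allFin (λ b → c b ∧ (minB b <ᵇ x) ∧ (x <ᵇ maxB b)))
                           (sum-cong-≗ (λ b → 𝟙-∧-∧ (c b) (minB b <ᵇ x) (x <ᵇ maxB b)))

  ∑-straddle : ∀ (c : Fin k → Bool) x → (∀ b → T (c b) → x ≢ maxB b) →
    ∑[ b < k ] (𝟙 (c b) * 𝟙 (minB b <ᵇ x)) ≡ ∑[ b < k ] (𝟙 (c b) * 𝟙 (maxB b <ᵇ x)) + spanning c x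
  ∑-straddle c x x≢max = trans (sum-cong-≗ straddle) (∑-distrib-+ (λ b → 𝟙 (c b) * 𝟙 (maxB b <ᵇ x)) _)
    where
    straddle : ∀ b → 𝟙 (c b) * 𝟙 (minB b <ᵇ x)
                   ≡ 𝟙 (c b) * 𝟙 (maxB b <ᵇ x) + 𝟙 (c b) * (𝟙 (minB b <ᵇ x) * 𝟙 (x <ᵇ maxB b))
    straddle b = trans (𝟙*-cong (c b) (λ cb → 𝟙-<ᵇ-straddle (minB≤maxB b) (x≢max b cb)))
                       (*-distribˡ-+ (𝟙 (c b)) _ _)

  opened-before-split : ∀ i (rel : ℕ → Bool) → (∀ b → T (rel (toℕ b)) → lookup π i ≢ b) →
    cnt (λ j → (toℕ j <ᵇ toℕ i) ∧ opener j ∧ rel (blk j)) elems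
    ≡ cnt (λ j → (toℕ j <ᵇ toℕ i) ∧ closer j ∧ rel (blk j)) elems
      + cnt (λ b → rel (toℕ b) ∧ (minB b <ᵇ toℕ i) ∧ (toℕ i <ᵇ maxB b)) blocks
  opened-before-split i rel rel⇒≢ = begin
    cnt (λ j → (toℕ j <ᵇ toℕ i) ∧ opener j ∧ rel (blk j)) elems
      ≡⟨ openers-before rel (toℕ i) ⟩
    ∑[ b < k ] (𝟙 (rel (toℕ b)) * 𝟙 (minB b <ᵇ toℕ i))
      ≡⟨ ∑-straddle (rel ∘ toℕ) (toℕ i) (λ b rb → ≢block⇒≢maxB (rel⇒≢ b rb)) ⟩
    ∑[ b < k ] (𝟙 (rel (toℕ b)) * 𝟙 (maxB b <ᵇ toℕ i)) + spanning (rel ∘ toℕ) (toℕ i)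
      ≡⟨ sym (cong₂ _+_ (closers-before rel (toℕ i)) (cnt-spanning (rel ∘ toℕ) (toℕ i))) ⟩
    cnt (λ j → (toℕ j <ᵇ toℕ i) ∧ closer j ∧ rel (blk j)) elems
      + cnt (λ b → rel (toℕ b) ∧ (minB b <ᵇ toℕ i) ∧ (toℕ i <ᵇ maxB b)) blocks ∎

  ros≡rcs+rsb : ∀ i → ros i ≡ rcs i + rsb i
  ros≡rcs+rsb i = opened-before-split i (blk i <ᵇ_) (λ b i<b i∈b → <⇒≢ (<ᵇ⇒< _ _ i<b) (cong toℕ i∈b))

  los≡lcs+lsb : ∀ i → los i ≡ lcs i + lsb i
  los≡lcs+lsb i = opened-before-split i (_<ᵇ blk i) (λ b b<i i∈b → <⇒≢ (<ᵇ⇒< _ _ b<i) (cong toℕ (sym i∈b)))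

  rsb-on-openers : totOn OS rsb ≡ ∑[ a < k ] spanning (λ b → toℕ a <ᵇ toℕ b) (minB a)
  rsb-on-openers = begin
    totOn OS rsb
      ≡⟨ totOn-OS π rsb ⟩
    ∑[ i < n ] (𝟙 (opener i) * rsb i)
      ≡⟨ sum-cong-≗ (λ i → cong (𝟙 (opener i) *_) (cnt-spanning (λ b → blk i <ᵇ toℕ b) (toℕ i))) ⟩
    ∑[ i < n ] (𝟙 (opener i) * spanning (λ b → blk i <ᵇ toℕ b) (toℕ i))
      ≡⟨ ∑-openers (λ y a → spanning (λ b → toℕ a <ᵇ toℕ b) y) ⟩
    ∑[ a < k ] spanning (λ b → toℕ a <ᵇ toℕ b) (minB a) ∎

  inv≡bInv+rsb : inv ≡ bInv + totOn OS rsb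
  inv≡bInv+rsb = begin
    inv
      ≡⟨ cnt-pairs π _ ⟩
    ∑[ a < k ] ∑[ b < k ] (𝟙 (toℕ a <ᵇ toℕ b) * 𝟙 (minB b <ᵇ minB a))
      ≡⟨ sum-cong-≗ (λ a → ∑-straddle (λ b → toℕ a <ᵇ toℕ b) (minB a) (λ b a<b → minB≢maxB (toℕ-<ᵇ⇒≢ a<b))) ⟩
    ∑[ a < k ] (∑[ b < k ] (𝟙 (toℕ a <ᵇ toℕ b) * 𝟙 (maxB b <ᵇ minB a)) + spanning (λ b → toℕ a <ᵇ toℕ b) (minB a))
      ≡⟨ ∑-distrib-+ (λ a → ∑[ b < k ] (𝟙 (toℕ a <ᵇ toℕ b) * 𝟙 (maxB b <ᵇ minB a))) _ ⟩
    ∑[ a < k ] ∑[ b < k ] (𝟙 (toℕ a <ᵇ toℕ b) * 𝟙 (maxB b <ᵇ minB a))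
      + ∑[ a < k ] spanning (λ b → toℕ a <ᵇ toℕ b) (minB a)
      ≡⟨ cong₂ _+_ (sym (cnt-pairs π _)) (sym rsb-on-openers) ⟩
    bInv + totOn OS rsb ∎

  rcs-on-openers : totOn OS rcs ≡ bInv
  rcs-on-openers = begin
    totOn OS rcs
      ≡⟨ totOn-OS π rcs ⟩
    ∑[ i < n ] (𝟙 (opener i) * rcs i)
      ≡⟨ sum-cong-≗ (λ i → cong (𝟙 (opener i) *_) (closers-before (blk i <ᵇ_) (toℕ i))) ⟩
    ∑[ i < n ] (𝟙 (opener i) * ∑[ b < k ] (𝟙 (blk i <ᵇ toℕ b) * 𝟙 (maxB b <ᵇ toℕ i)))
      ≡⟨ ∑-openers (λ y a → ∑[ b < k ] (𝟙 (toℕ a <ᵇ toℕ b) * 𝟙 (maxB b <ᵇ y))) ⟩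
    ∑[ a < k ] ∑[ b < k ] (𝟙 (toℕ a <ᵇ toℕ b) * 𝟙 (maxB b <ᵇ minB a))
      ≡⟨ sym (cnt-pairs π _) ⟩
    bInv ∎

  noninv : ℕ
  noninv = ∑[ a < k ] ∑[ b < k ] (𝟙 (toℕ a <ᵇ toℕ b) * 𝟙 (minB a <ᵇ minB b))

  noninv+inv≡k[C]2 : noninv + inv ≡ k C 2
  noninv+inv≡k[C]2 = begin
    noninv + inv
      ≡⟨ cong (_+_ noninv) (cnt-pairs π _) ⟩
    noninv + ∑[ a < k ] ∑[ b < k ] (𝟙 (toℕ a <ᵇ toℕ b) * 𝟙 (minB b <ᵇ minB a))
      ≡⟨ sym (∑-distrib-+ (λ a → ∑[ b < k ] (𝟙 (toℕ a <ᵇ toℕ b) * 𝟙 (minB a <ᵇ minB b))) _) ⟩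
    ∑[ a < k ] (∑[ b < k ] (𝟙 (toℕ a <ᵇ toℕ b) * 𝟙 (minB a <ᵇ minB b))
                + ∑[ b < k ] (𝟙 (toℕ a <ᵇ toℕ b) * 𝟙 (minB b <ᵇ minB a)))
      ≡⟨ sum-cong-≗ (λ a → sym (∑-distrib-+ (λ b → 𝟙 (toℕ a <ᵇ toℕ b) * 𝟙 (minB a <ᵇ minB b)) _)) ⟩
    ∑[ a < k ] ∑[ b < k ] (𝟙 (toℕ a <ᵇ toℕ b) * 𝟙 (minB a <ᵇ minB b) + 𝟙 (toℕ a <ᵇ toℕ b) * 𝟙 (minB b <ᵇ minB a))
      ≡⟨ sum-cong-≗ (λ a → sum-cong-≗ (λ b → ordered-by-minB a b)) ⟩
    ∑[ a < k ] ∑[ b < k ] 𝟙 (toℕ a <ᵇ toℕ b)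
      ≡⟨ ∑∑-𝟙-<ᵇ k ⟩
    k C 2 ∎
    where
    ordered-by-minB : ∀ a b → 𝟙 (toℕ a <ᵇ toℕ b) * 𝟙 (minB a <ᵇ minB b) + 𝟙 (toℕ a <ᵇ toℕ b) * 𝟙 (minB b <ᵇ minB a)
                              ≡ 𝟙 (toℕ a <ᵇ toℕ b)
    ordered-by-minB a b = trans (sym (*-distribˡ-+ (𝟙 (toℕ a <ᵇ toℕ b)) _ _))
      (trans (𝟙*-cong (toℕ a <ᵇ toℕ b) (λ a<b → 𝟙-<ᵇ-total (toℕ-<ᵇ⇒≢ a<b ∘ minB-injective)))
             (*-identityʳ _))

  cinv≡noninv : cinv ≡ noninv
  cinv≡noninv = trans (cong (_∸ inv) (sym noninv+inv≡k[C]2)) (m+n∸n≡m noninv inv)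

  cinv+inv≡k[C]2 : cinv + inv ≡ k C 2
  cinv+inv≡k[C]2 = trans (cong (_+ inv) cinv≡noninv) noninv+inv≡k[C]2

  los-on-openers : totOn OS los ≡ cinv
  los-on-openers = begin
    totOn OS los
      ≡⟨ totOn-OS π los ⟩
    ∑[ i < n ] (𝟙 (opener i) * los i)
      ≡⟨ sum-cong-≗ (λ i → cong (𝟙 (opener i) *_) (openers-before (_<ᵇ blk i) (toℕ i))) ⟩
    ∑[ i < n ] (𝟙 (opener i) * ∑[ b < k ] (𝟙 (toℕ b <ᵇ blk i) * 𝟙 (minB b <ᵇ toℕ i)))
      ≡⟨ ∑-openers (λ y a → ∑[ b < k ] (𝟙 (toℕ b <ᵇ toℕ a) * 𝟙 (minB b <ᵇ y))) ⟩
    ∑[ a < k ] ∑[ b < k ] (𝟙 (toℕ b <ᵇ toℕ a) * 𝟙 (minB b <ᵇ minB a))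
      ≡⟨ ∑-comm (λ a b → 𝟙 (toℕ b <ᵇ toℕ a) * 𝟙 (minB b <ᵇ minB a)) ⟩
    noninv
      ≡⟨ sym cinv≡noninv ⟩
    cinv ∎

  φx≡fx+inv : φx ≡ fx + inv
  φx≡fx+inv = begin
    tot ros + tot lcs + bInv
      ≡⟨ cong (λ r → r + tot lcs + bInv) (trans (tot-+ π ros≡rcs+rsb) (cong (_+_ (tot rcs)) (tot-split π rsb))) ⟩
    tot rcs + (totOn OS rsb + totOn TC rsb) + tot lcs + bInv
      ≡⟨ shuffle (tot rcs) (totOn OS rsb) (totOn TC rsb) (tot lcs) bInv ⟩
    tot lcs + tot rcs + totOn TC rsb + (bInv + totOn OS rsb)
      ≡⟨ cong (_+_ (tot lcs + tot rcs + totOn TC rsb)) (sym inv≡bInv+rsb) ⟩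
    fx + inv ∎
    where
    shuffle : ∀ r o t l b → r + (o + t) + l + b ≡ l + r + t + (b + o)
    shuffle = solve-∀

  φy≡fy+inv+2cinv : φy ≡ fy + inv + 2 * cinv
  φy≡fy+inv+2cinv = trans (cong (_∸ bInv) lsb+pairs) (m+n∸n≡m (fy + inv + 2 * cinv) bInv)
    where
    shuffle : ∀ l t o c b → l + t + 2 * (c + (b + o)) ≡ l + o + t + (b + o) + 2 * c + b
    shuffle = solve-∀
    lsb+pairs : tot lsb + 2 * (k C 2) ≡ fy + inv + 2 * cinv + bInv
    lsb+pairs = begin
      tot lsb + 2 * (k C 2)
        ≡⟨ cong₂ (λ t c → t + 2 * c) (tot-split π lsb) (sym cinv+inv≡k[C]2) ⟩
      totOn OS lsb + totOn TC lsb + 2 * (cinv + inv)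
        ≡⟨ cong (λ v → totOn OS lsb + totOn TC lsb + 2 * (cinv + v)) inv≡bInv+rsb ⟩
      totOn OS lsb + totOn TC lsb + 2 * (cinv + (bInv + totOn OS rsb))
        ≡⟨ shuffle (totOn OS lsb) (totOn TC lsb) (totOn OS rsb) cinv bInv ⟩
      fy + (bInv + totOn OS rsb) + 2 * cinv + bInv
        ≡⟨ cong (λ v → fy + v + 2 * cinv + bInv) (sym inv≡bInv+rsb) ⟩
      fy + inv + 2 * cinv + bInv ∎

  los+rcs≡gz+cinv+bInv : tot los + tot rcs ≡ gz + cinv + bInv
  los+rcs≡gz+cinv+bInv = begin
    tot los + tot rcs
      ≡⟨ cong₂ _+_ (tot-split π los) (tot-split π rcs) ⟩
    totOn OS los + totOn TC los + (totOn OS rcs + totOn TC rcs)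
      ≡⟨ cong₂ (λ u v → u + totOn TC los + (v + totOn TC rcs)) los-on-openers rcs-on-openers ⟩
    cinv + totOn TC los + (bInv + totOn TC rcs)
      ≡⟨ cong (λ u → cinv + u + (bInv + totOn TC rcs)) (totOn-+ π TC los≡lcs+lsb) ⟩
    cinv + (totOn TC lcs + totOn TC lsb) + (bInv + totOn TC rcs)
      ≡⟨ shuffle cinv (totOn TC lcs) (totOn TC lsb) bInv (totOn TC rcs) ⟩
    gz + cinv + bInv ∎
    where
    shuffle : ∀ c l s b r → c + (l + s) + (b + r) ≡ l + r + s + c + b
    shuffle = solve-∀

  ϕz≡n[k-1]-gz-cinv : ϕz ≡ (+ n) ℤ.* ((+ k) ℤ.- (+ 1)) ℤ.- (+ gz) ℤ.- (+ cinv)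
  ϕz≡n[k-1]-gz-cinv = begin
    (+ n) ℤ.* ((+ k) ℤ.- (+ 1)) ℤ.- (+ (tot los + tot rcs)) ℤ.+ (+ bInv)
      ≡⟨ cong (λ m → (+ n) ℤ.* ((+ k) ℤ.- (+ 1)) ℤ.- (+ m) ℤ.+ (+ bInv)) los+rcs≡gz+cinv+bInv ⟩
    (+ n) ℤ.* ((+ k) ℤ.- (+ 1)) ℤ.- ((+ gz) ℤ.+ (+ cinv) ℤ.+ (+ bInv)) ℤ.+ (+ bInv)
      ≡⟨ cancel ((+ n) ℤ.* ((+ k) ℤ.- (+ 1))) (+ gz) (+ cinv) (+ bInv) ⟩
    (+ n) ℤ.* ((+ k) ℤ.- (+ 1)) ℤ.- (+ gz) ℤ.- (+ cinv) ∎
    where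
    cancel : ∀ m g c b → m ℤ.- (g ℤ.+ c ℤ.+ b) ℤ.+ b ≡ m ℤ.- g ℤ.- c
    cancel = ℤ-Solver.solve-∀

cnt-OP-cong : ∀ {n k} {p q : Vec (Fin k) n → Bool} →
  (∀ π → T (isSurj π) → p π ≡ q π) → cnt p (OP n k) ≡ cnt q (OP n k)
cnt-OP-cong {n} {k} {p} {q} p≡q = begin
  cnt p (OP n k)
    ≡⟨ cnt-filter isSurj p (allVecs n k) ⟩
  cnt (λ π → isSurj π ∧ p π) (allVecs n k)
    ≡⟨ cnt-cong (λ π → ∧-congˡ-T (isSurj π) (p≡q π)) (allVecs n k) ⟩
  cnt (λ π → isSurj π ∧ q π) (allVecs n k)
    ≡⟨ sym (cnt-filter isSurj q (allVecs n k)) ⟩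
  cnt q (OP n k) ∎

lemma3p11 : (k : ℕ) →
    ((n i j p q : ℕ) →
      cnt (λ π → let open Stats π in
             (φx ≡ᵇ i) ∧ (φy ≡ᵇ j) ∧ (inv ≡ᵇ p) ∧ (cinv ≡ᵇ q)) (OP n k)
      ≡ cnt (λ π → let open Stats π in
             ((fx + inv) ≡ᵇ i) ∧ ((fy + inv + 2 * cinv) ≡ᵇ j) ∧ (inv ≡ᵇ p) ∧ (cinv ≡ᵇ q)) (OP n k))
    × ((n : ℕ) (e : ℤ) (p q : ℕ) →
      cnt (λ π → let open Stats π in
             ⌊ ϕz ℤ.≟ e ⌋ ∧ (inv ≡ᵇ p) ∧ (cinv ≡ᵇ q)) (OP n k)
      ≡ cnt (λ π → let open Stats π in
             ⌊ ((+ n) ℤ.* ((+ k) ℤ.- (+ 1)) ℤ.- (+ gz) ℤ.- (+ cinv)) ℤ.≟ e ⌋ ∧ (inv ≡ᵇ p) ∧ (cinv ≡ᵇ q)) (OP n k))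
lemma3p11 k =
  (λ n i j p q → cnt-OP-cong {n} {k} λ π surj →
     cong₂ (λ x y → (x ≡ᵇ i) ∧ (y ≡ᵇ j) ∧ (Stats.inv π ≡ᵇ p) ∧ (Stats.cinv π ≡ᵇ q))
           (Surjective.φx≡fx+inv π surj) (Surjective.φy≡fy+inv+2cinv π surj)) ,
  (λ n e p q → cnt-OP-cong {n} {k} λ π surj →
     cong (λ z → ⌊ z ℤ.≟ e ⌋ ∧ (Stats.inv π ≡ᵇ p) ∧ (Stats.cinv π ≡ᵇ q))
          (Surjective.ϕz≡n[k-1]-gz-cinv π surj))
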